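{- For all positive integers $r$ and $k$ and every nonnegative integer $n$, $$\det\left(\binom{i+(r-1)j+k}{i-j+1}\right)_{i,j=0}^{n-1}=\det\left(\binom{(r-1)j+k}{i-j+1}\right)_{i,j=0}^{n-1}=\frac{k}{rn+k}\binom{rn+k}{n}.$$
   Context: Binomial coefficients $\binom{a}{b}$ with $a\ge0$ vanish if $b<0$ or $b>a$. Determinants of $0\times0$ matrices equal $1$. -}

module Defs where

open import Data.Nat as ℕ using (ℕ; zero; suc)
open import Data.Nat.Combinatorics using (_C_)
open import Data.Integer as ℤ using (ℤ; +_; -[1+_])
open import Data.Fin using (Fin; zero; suc; toℕ; punchIn)

-- Binomial coefficient (a choose b) for a natural top a ≥ 0 and an integer
-- bottom b: zero when b < 0; for b ≥ 0 this is the stdlib a C b, which is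
-- zero when b > a.
binomℤ : ℕ → ℤ → ℕ
binomℤ a (+ b)    = a C b
binomℤ a -[1+ _ ] = 0

signℤ : ℕ → ℤ
signℤ zero          = + 1
signℤ (suc zero)    = ℤ.- (+ 1)
signℤ (suc (suc i)) = signℤ i

sumFin : ∀ {n} → (Fin n → ℤ) → ℤ
sumFin {zero}  f = + 0
sumFin {suc n} f = f zero ℤ.+ sumFin (λ j → f (suc j))

det : ∀ n → (Fin n → Fin n → ℤ) → ℤ
det zero    M = + 1
det (suc n) M =
  sumFin (λ (j : Fin (suc n)) →
    signℤ (toℕ j) ℤ.* M zero j ℤ.* det n (λ a b → M (suc a) (punchIn j b)))

matA : ℕ → ℕ → ∀ n → Fin n → Fin n → ℤ
matA r k n i j =
  + binomℤ (toℕ i ℕ.+ (r ℕ.∸ 1) ℕ.* toℕ j ℕ.+ k)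
           ((+ toℕ i) ℤ.- (+ toℕ j) ℤ.+ + 1)

matB : ℕ → ℕ → ∀ n → Fin n → Fin n → ℤ
matB r k n i j =
  + binomℤ ((r ℕ.∸ 1) ℕ.* toℕ j ℕ.+ k)
           ((+ toℕ i) ℤ.- (+ toℕ j) ℤ.+ + 1)

-- Both matrices have the shape [c | t]: a first column c followed by a unit lower-triangular
-- matrix t, so the first row has only two nonzero entries and expanding along it gives
--   det [c | t] = c₀ · det [t₁₀, t₂₀, … | t↘] − det [c₁, c₂, … | t↘],
-- where t↘ is t with its first row and column removed. For the binomial matrices, t↘ is again a
-- member of the same family, and the first column obeys Pascal's rule in its parameter. The
-- Fuss–Catalan numbers F x n = x/(rn+x) · C(rn+x, n), i.e. the coefficients of B^x where
-- B = 1 + z B^r, satisfy the matching rule F (y+1) (n+1) = F y (n+1) + F (y+r) n (from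
-- B^(y+1) = B^y + z B^(y+r)). A simultaneous induction on the size n and the column parameter a
-- then shows that the determinant with first column of parameter a is F (y+a) n − F y n, where y
-- records how far the remaining columns are shifted; taking a = k, y = 0 gives F k n for both.
module Submission where

open import Defs
open import Data.Nat as ℕ using (ℕ; zero; suc; _+_; _*_; _≥_)
import Data.Nat.Properties as ℕₚ
open import Data.Nat.Combinatorics using (_C_; nC1≡n; nCk+nC[k+1]≡[n+1]C[k+1]; k>n⇒nCk≡0)
open import Data.Integer as ℤ using (ℤ; +_; -[1+_]; _⊖_)
import Data.Integer.Properties as ℤₚ
open import Data.Fin using (Fin; zero; suc; toℕ; punchIn)
open import Data.Product using (_×_; _,_)
open import Function using (_∘_)
open import Relation.Binary.PropositionalEquality
import Data.Nat.Tactic.RingSolver as ℕ-Ring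
import Data.Integer.Tactic.RingSolver as ℤ-Ring

C-absorption : ∀ n k → suc k * (suc n C suc k) ≡ suc n * (n C k)
C-absorption zero    zero    = refl
C-absorption zero    (suc k) = ℕₚ.*-zeroʳ (suc (suc k))
C-absorption (suc n) zero    = begin
  1 * (suc (suc n) C 1) ≡⟨ ℕₚ.*-identityˡ _ ⟩
  suc (suc n) C 1       ≡⟨ nC1≡n (suc (suc n)) ⟩
  suc (suc n)           ≡⟨ ℕₚ.*-identityʳ (suc (suc n)) ⟨
  suc (suc n) * 1       ∎
  where open ≡-Reasoning
C-absorption (suc n) (suc k) = begin
  suc (suc k) * (suc (suc n) C suc (suc k))
    ≡⟨ cong (suc (suc k) *_) (nCk+nC[k+1]≡[n+1]C[k+1] (suc n) (suc k)) ⟨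
  suc (suc k) * (a + b)
    ≡⟨ split k a b ⟩
  a + (suc k * a + suc (suc k) * b)
    ≡⟨ cong₂ (λ x y → a + (x + y)) (C-absorption n k) (C-absorption n (suc k)) ⟩
  a + (suc n * (n C k) + suc n * (n C suc k))
    ≡⟨ cong (λ x → a + x) (ℕₚ.*-distribˡ-+ (suc n) (n C k) (n C suc k)) ⟨
  a + suc n * (n C k + n C suc k)
    ≡⟨ cong (λ x → a + suc n * x) (nCk+nC[k+1]≡[n+1]C[k+1] n k) ⟩
  suc (suc n) * a ∎
  where
  open ≡-Reasoning
  split : ∀ k a b → suc (suc k) * (a + b) ≡ a + (suc k * a + suc (suc k) * b)
  split = ℕ-Ring.solve-∀
  a = suc n C suc k
  b = suc n C suc (suc k)

pascalℤ : ∀ n k → + (suc n C suc k) ≡ + (n C k) ℤ.+ + (n C suc k)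
pascalℤ n k = cong +_ (sym (nCk+nC[k+1]≡[n+1]C[k+1] n k))

-- Determinants with a distinguished first column

sumFin-cong : ∀ {n} {f g : Fin n → ℤ} → (∀ i → f i ≡ g i) → sumFin f ≡ sumFin g
sumFin-cong {zero}  f≗g = refl
sumFin-cong {suc n} f≗g = cong₂ ℤ._+_ (f≗g zero) (sumFin-cong (f≗g ∘ suc))

sumFin-zero : ∀ {n} {f : Fin n → ℤ} → (∀ i → f i ≡ + 0) → sumFin f ≡ + 0
sumFin-zero {zero}  f≗0 = refl
sumFin-zero {suc n} f≗0 = cong₂ ℤ._+_ (f≗0 zero) (sumFin-zero (f≗0 ∘ suc))

det-cong : ∀ n {M N : Fin n → Fin n → ℤ} → (∀ i j → M i j ≡ N i j) → det n M ≡ det n N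
det-cong zero    M≗N = refl
det-cong (suc n) M≗N = sumFin-cong λ j →
  cong₂ ℤ._*_ (cong (signℤ (toℕ j) ℤ.*_) (M≗N zero j))
              (det-cong n λ a b → M≗N (suc a) (punchIn j b))

infixr 5 _◂_

_◂_ : ∀ {A : Set} → A → (ℕ → A) → ℕ → A
(x ◂ f) zero    = x
(x ◂ f) (suc i) = f i

bordered : (ℕ → ℤ) → (ℕ → ℕ → ℤ) → ∀ n → Fin n → Fin n → ℤ
bordered c t n i j = (c (toℕ i) ◂ t (toℕ i)) (toℕ j)

borderedDet : (ℕ → ℤ) → (ℕ → ℕ → ℤ) → ℕ → ℤ
borderedDet c t n = det n (bordered c t n)

borderedDet-cong : ∀ {c c′ t t′} n → (∀ i → c i ≡ c′ i) → (∀ i j → t i j ≡ t′ i j) →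
                   borderedDet c t n ≡ borderedDet c′ t′ n
borderedDet-cong n c≗c′ t≗t′ = det-cong n λ where
  i zero    → c≗c′ (toℕ i)
  i (suc j) → t≗t′ (toℕ i) (toℕ j)

record UnitLowerTriangular (t : ℕ → ℕ → ℤ) : Set where
  field
    diagonal : ∀ i → t i i ≡ + 1
    above    : ∀ i j → t i (suc (i + j)) ≡ + 0

lowerRight : (ℕ → ℕ → ℤ) → ℕ → ℕ → ℤ
lowerRight t i j = t (suc i) (suc j)

lowerRight-unitLowerTriangular : ∀ {t} → UnitLowerTriangular t →
                                 UnitLowerTriangular (lowerRight t)
lowerRight-unitLowerTriangular T = record { diagonal = diagonal ∘ suc ; above = above ∘ suc }
  where open UnitLowerTriangular T

dropFirstRowDet : (ℕ → ℕ → ℤ) → ℕ → ℤ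
dropFirstRowDet t = borderedDet (λ i → t (suc i) 0) (lowerRight t)

borderedDet-one : ∀ c t → borderedDet c t 1 ≡ c 0
borderedDet-one c t = unit (c 0)
  where
  unit : ∀ x → + 1 ℤ.* x ℤ.* + 1 ℤ.+ + 0 ≡ x
  unit = ℤ-Ring.solve-∀

borderedDet-expand : ∀ c {t} m → UnitLowerTriangular t →
  borderedDet c t (suc (suc m)) ≡
  c 0 ℤ.* dropFirstRowDet t (suc m) ℤ.- borderedDet (c ∘ suc) (lowerRight t) (suc m)
borderedDet-expand c {t} m T = begin
  term zero ℤ.+ (term (suc zero) ℤ.+ sumFin (λ (j : Fin m) → term (suc (suc j))))
    ≡⟨ cong₂ ℤ._+_ (cong (+ 1 ℤ.* c 0 ℤ.*_) minor₀)
         (cong₂ ℤ._+_ (cong₂ (λ x y → ℤ.- + 1 ℤ.* x ℤ.* y) (diagonal 0) minor₁)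
                      (sumFin-zero vanishing)) ⟩
  + 1 ℤ.* c 0 ℤ.* E ℤ.+ (ℤ.- + 1 ℤ.* + 1 ℤ.* S ℤ.+ + 0)
    ≡⟨ simplify (c 0) E S ⟩
  c 0 ℤ.* E ℤ.- S ∎
  where
  open ≡-Reasoning
  open UnitLowerTriangular T
  E = dropFirstRowDet t (suc m)
  S = borderedDet (c ∘ suc) (lowerRight t) (suc m)
  minorMatrix : Fin (suc (suc m)) → Fin (suc m) → Fin (suc m) → ℤ
  minorMatrix j a b = bordered c t (suc (suc m)) (suc a) (punchIn j b)
  minor : Fin (suc (suc m)) → ℤ
  minor j = det (suc m) (minorMatrix j)
  term : Fin (suc (suc m)) → ℤ
  term j = signℤ (toℕ j) ℤ.* (c 0 ◂ t 0) (toℕ j) ℤ.* minor j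
  minor₀ : minor zero ≡ E
  minor₀ = det-cong (suc m) {minorMatrix zero}
                            {bordered (λ i → t (suc i) 0) (lowerRight t) (suc m)}
    λ a → λ { zero → refl ; (suc b) → refl }
  minor₁ : minor (suc zero) ≡ S
  minor₁ = det-cong (suc m) {minorMatrix (suc zero)} {bordered (c ∘ suc) (lowerRight t) (suc m)}
    λ a → λ { zero → refl ; (suc b) → refl }
  vanishing : ∀ j → term (suc (suc j)) ≡ + 0
  vanishing j = begin
    signℤ (toℕ j) ℤ.* t 0 (suc (toℕ j)) ℤ.* minor (suc (suc j))
      ≡⟨ cong (λ x → signℤ (toℕ j) ℤ.* x ℤ.* minor (suc (suc j))) (above 0 (toℕ j)) ⟩
    signℤ (toℕ j) ℤ.* + 0 ℤ.* minor (suc (suc j))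
      ≡⟨ cong (ℤ._* minor (suc (suc j))) (ℤₚ.*-zeroʳ (signℤ (toℕ j))) ⟩
    + 0 ℤ.* minor (suc (suc j)) ∎
  simplify : ∀ x e s → + 1 ℤ.* x ℤ.* e ℤ.+ (ℤ.- + 1 ℤ.* + 1 ℤ.* s ℤ.+ + 0) ≡ x ℤ.* e ℤ.- s
  simplify = ℤ-Ring.solve-∀

borderedDet-zero : ∀ {t} m → UnitLowerTriangular t →
                   borderedDet (λ _ → + 0) t (suc m) ≡ + 0
borderedDet-zero {t} zero    T = borderedDet-one (λ _ → + 0) t
borderedDet-zero {t} (suc m) T = begin
  borderedDet (λ _ → + 0) t (suc (suc m))
    ≡⟨ borderedDet-expand (λ _ → + 0) m T ⟩
  + 0 ℤ.* E ℤ.- borderedDet (λ _ → + 0) (lowerRight t) (suc m)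
    ≡⟨ cong (λ x → + 0 ℤ.* E ℤ.- x)
            (borderedDet-zero {lowerRight t} m (lowerRight-unitLowerTriangular T)) ⟩
  + 0 ℤ.* E ℤ.- + 0
    ≡⟨ annihilate E ⟩
  + 0 ∎
  where
  open ≡-Reasoning
  E = dropFirstRowDet t (suc m)
  annihilate : ∀ e → + 0 ℤ.* e ℤ.- + 0 ≡ + 0
  annihilate = ℤ-Ring.solve-∀

borderedDet-+ : ∀ {c c′ t} m → UnitLowerTriangular t →
  borderedDet (λ i → c i ℤ.+ c′ i) t (suc m) ≡
  borderedDet c t (suc m) ℤ.+ borderedDet c′ t (suc m)
borderedDet-+ {c} {c′} {t} zero    T = begin
  borderedDet (λ i → c i ℤ.+ c′ i) t 1
    ≡⟨ borderedDet-one (λ i → c i ℤ.+ c′ i) t ⟩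
  c 0 ℤ.+ c′ 0
    ≡⟨ cong₂ ℤ._+_ (borderedDet-one c t) (borderedDet-one c′ t) ⟨
  borderedDet c t 1 ℤ.+ borderedDet c′ t 1 ∎
  where open ≡-Reasoning
borderedDet-+ {c} {c′} {t} (suc m) T = begin
  borderedDet (λ i → c i ℤ.+ c′ i) t (suc (suc m))
    ≡⟨ borderedDet-expand (λ i → c i ℤ.+ c′ i) m T ⟩
  (c 0 ℤ.+ c′ 0) ℤ.* E ℤ.- borderedDet (λ i → c (suc i) ℤ.+ c′ (suc i)) (lowerRight t) (suc m)
    ≡⟨ cong (λ x → (c 0 ℤ.+ c′ 0) ℤ.* E ℤ.- x)
            (borderedDet-+ {c ∘ suc} {c′ ∘ suc} m (lowerRight-unitLowerTriangular T)) ⟩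
  (c 0 ℤ.+ c′ 0) ℤ.* E ℤ.- (S ℤ.+ S′)
    ≡⟨ regroup (c 0) (c′ 0) E S S′ ⟩
  (c 0 ℤ.* E ℤ.- S) ℤ.+ (c′ 0 ℤ.* E ℤ.- S′)
    ≡⟨ cong₂ ℤ._+_ (borderedDet-expand c m T) (borderedDet-expand c′ m T) ⟨
  borderedDet c t (suc (suc m)) ℤ.+ borderedDet c′ t (suc (suc m)) ∎
  where
  open ≡-Reasoning
  E  = dropFirstRowDet t (suc m)
  S  = borderedDet (c ∘ suc) (lowerRight t) (suc m)
  S′ = borderedDet (c′ ∘ suc) (lowerRight t) (suc m)
  regroup : ∀ x x′ e s s′ →
            (x ℤ.+ x′) ℤ.* e ℤ.- (s ℤ.+ s′) ≡ (x ℤ.* e ℤ.- s) ℤ.+ (x′ ℤ.* e ℤ.- s′)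
  regroup = ℤ-Ring.solve-∀

-- Fuss–Catalan numbers

module FussCatalan (q : ℕ) where

  -- With r = q + 1, fussCatalan x (n + 1) is C(r(n+1)+x, n+1) − r·C(r(n+1)+x−1, n), which
  -- equals x/(r(n+1)+x) · C(r(n+1)+x, n+1) but avoids division; height x n is r(n+1)+x−1.
  height : ℕ → ℕ → ℕ
  height x n = q * suc n + n + x

  fussCatalan : ℕ → ℕ → ℤ
  fussCatalan x zero    = + 1
  fussCatalan x (suc n) = + (suc (height x n) C suc n) ℤ.- + suc q ℤ.* + (height x n C n)

  suc-height : ∀ x n → suc (height x n) ≡ suc q * suc n + x
  suc-height x n = identity q x n
    where
    identity : ∀ q x n → suc (q * suc n + n + x) ≡ suc q * suc n + x
    identity = ℕ-Ring.solve-∀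

  fussCatalan-zero : ∀ n → fussCatalan 0 (suc n) ≡ + 0
  fussCatalan-zero n = begin
    + (suc h C suc n) ℤ.- + suc q ℤ.* + (h C n)
      ≡⟨ cong (λ x → + x ℤ.- + suc q ℤ.* + (h C n)) absorbed ⟩
    + (suc q * (h C n)) ℤ.- + suc q ℤ.* + (h C n)
      ≡⟨ cong (ℤ._- + suc q ℤ.* + (h C n)) (ℤₚ.pos-* (suc q) (h C n)) ⟩
    + suc q ℤ.* + (h C n) ℤ.- + suc q ℤ.* + (h C n)
      ≡⟨ ℤₚ.+-inverseʳ (+ suc q ℤ.* + (h C n)) ⟩
    + 0 ∎
    where
    open ≡-Reasoning
    h = height 0 n
    absorbed : suc h C suc n ≡ suc q * (h C n)
    absorbed = ℕₚ.*-cancelˡ-≡ _ _ (suc n) (begin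
      suc n * (suc h C suc n)       ≡⟨ C-absorption h n ⟩
      suc h * (h C n)               ≡⟨ cong (ℕ._* (h C n)) (suc-height 0 n) ⟩
      (suc q * suc n + 0) * (h C n) ≡⟨ rearrange q n (h C n) ⟩
      suc n * (suc q * (h C n))     ∎)
      where
      rearrange : ∀ q n y → (suc q * suc n + 0) * y ≡ suc n * (suc q * y)
      rearrange = ℕ-Ring.solve-∀

  fussCatalan-one : ∀ x → fussCatalan x 1 ≡ + x
  fussCatalan-one x = begin
    + (suc (height x 0) C 1) ℤ.- + suc q ℤ.* + 1
      ≡⟨ cong (λ z → + z ℤ.- + suc q ℤ.* + 1) (trans (nC1≡n _) (suc-height x 0)) ⟩
    + (suc q * 1) ℤ.+ + x ℤ.- + suc q ℤ.* + 1
      ≡⟨ cong (λ z → z ℤ.+ + x ℤ.- + suc q ℤ.* + 1) (ℤₚ.pos-* (suc q) 1) ⟩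
    + suc q ℤ.* + 1 ℤ.+ + x ℤ.- + suc q ℤ.* + 1
      ≡⟨ cancel (+ suc q ℤ.* + 1) (+ x) ⟩
    + x ∎
    where
    open ≡-Reasoning
    cancel : ∀ a x → a ℤ.+ x ℤ.- a ≡ x
    cancel = ℤ-Ring.solve-∀

  fussCatalan-pascal : ∀ y n →
    fussCatalan (suc y) (suc n) ≡ fussCatalan y (suc n) ℤ.+ fussCatalan (y + suc q) n
  fussCatalan-pascal y zero = begin
    fussCatalan (suc y) 1   ≡⟨ fussCatalan-one (suc y) ⟩
    + suc y                 ≡⟨ cong +_ (ℕₚ.+-comm 1 y) ⟩
    + y ℤ.+ + 1             ≡⟨ cong (ℤ._+ + 1) (fussCatalan-one y) ⟨
    fussCatalan y 1 ℤ.+ + 1 ∎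
    where open ≡-Reasoning
  fussCatalan-pascal y (suc m) = begin
    + (suc H₁ C suc (suc m)) ℤ.- r ℤ.* + (H₁ C suc m)
      ≡⟨ cong (λ h → + (suc h C suc (suc m)) ℤ.- r ℤ.* + (h C suc m)) H₁≡U+1 ⟩
    + (suc (suc U) C suc (suc m)) ℤ.- r ℤ.* + (suc U C suc m)
      ≡⟨ cong₂ (λ x y → x ℤ.- r ℤ.* y)
               (trans (pascalℤ (suc U) (suc m)) (cong (ℤ._+ c) (pascalℤ U m)))
               (pascalℤ U m) ⟩
    (a ℤ.+ b ℤ.+ c) ℤ.- r ℤ.* (a ℤ.+ b)
      ≡⟨ regroup a b c r ⟩
    (c ℤ.- r ℤ.* b) ℤ.+ ((a ℤ.+ b) ℤ.- r ℤ.* a)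
      ≡⟨ cong (λ x → (c ℤ.- r ℤ.* b) ℤ.+ (x ℤ.- r ℤ.* a)) (pascalℤ U m) ⟨
    (c ℤ.- r ℤ.* b) ℤ.+ (+ (suc U C suc m) ℤ.- r ℤ.* a)
      ≡⟨ cong (λ h → (c ℤ.- r ℤ.* b) ℤ.+ (+ (suc h C suc m) ℤ.- r ℤ.* + (h C m))) H₂≡U ⟨
    fussCatalan y (suc (suc m)) ℤ.+ fussCatalan (y + suc q) (suc m) ∎
    where
    open ≡-Reasoning
    r  = + suc q
    U  = height y (suc m)
    H₁ = height (suc y) (suc m)
    H₂ = height (y + suc q) m
    a = + (U C m)
    b = + (U C suc m)
    c = + (suc U C suc (suc m))
    H₁≡U+1 : H₁ ≡ suc U
    H₁≡U+1 = shift q y m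
      where
      shift : ∀ q y m → q * suc (suc m) + suc m + suc y ≡ suc (q * suc (suc m) + suc m + y)
      shift = ℕ-Ring.solve-∀
    H₂≡U : H₂ ≡ U
    H₂≡U = shift q y m
      where
      shift : ∀ q y m → q * suc m + m + (y + suc q) ≡ q * suc (suc m) + suc m + y
      shift = ℕ-Ring.solve-∀
    regroup : ∀ a b c r →
              (a ℤ.+ b ℤ.+ c) ℤ.- r ℤ.* (a ℤ.+ b) ≡ (c ℤ.- r ℤ.* b) ℤ.+ ((a ℤ.+ b) ℤ.- r ℤ.* a)
    regroup = ℤ-Ring.solve-∀

  fussCatalan-closed : ∀ k n →
    + (suc q * n + k) ℤ.* fussCatalan k n ≡ + (k * ((suc q * n + k) C n))
  fussCatalan-closed k zero = begin
    + (suc q * 0 + k) ℤ.* + 1 ≡⟨ ℤₚ.*-identityʳ _ ⟩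
    + (suc q * 0 + k)         ≡⟨ cong (λ z → + (z + k)) (ℕₚ.*-zeroʳ (suc q)) ⟩
    + k                       ≡⟨ cong +_ (ℕₚ.*-identityʳ k) ⟨
    + (k * 1)                 ∎
    where open ≡-Reasoning
  fussCatalan-closed k (suc n) = begin
    + S ℤ.* (+ (suc h C suc n) ℤ.- r ℤ.* + (h C n))
      ≡⟨ cong (λ z → + S ℤ.* (+ (z C suc n) ℤ.- r ℤ.* + (h C n))) (suc-height k n) ⟩
    + S ℤ.* (X ℤ.- r ℤ.* Y)
      ≡⟨ distribute (+ S) X r Y ⟩
    + S ℤ.* X ℤ.- r ℤ.* (+ S ℤ.* Y)
      ≡⟨ cong (λ z → + S ℤ.* X ℤ.- r ℤ.* z) absorbed ⟩
    + S ℤ.* X ℤ.- r ℤ.* (N ℤ.* X)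
      ≡⟨⟩
    (r ℤ.* N ℤ.+ + k) ℤ.* X ℤ.- r ℤ.* (N ℤ.* X)
      ≡⟨ cancel r N (+ k) X ⟩
    + k ℤ.* X
      ≡⟨ ℤₚ.pos-* k (S C suc n) ⟨
    + (k * (S C suc n)) ∎
    where
    open ≡-Reasoning
    r = + suc q
    N = + suc n
    h = height k n
    S = suc q * suc n + k
    X = + (S C suc n)
    Y = + (h C n)
    absorbed : + S ℤ.* Y ≡ N ℤ.* X
    absorbed = begin
      + S ℤ.* Y                   ≡⟨ ℤₚ.pos-* S (h C n) ⟨
      + (S * (h C n))             ≡⟨ cong (λ z → + (z * (h C n))) (suc-height k n) ⟨
      + (suc h * (h C n))         ≡⟨ cong +_ (C-absorption h n) ⟨
      + (suc n * (suc h C suc n)) ≡⟨ cong (λ z → + (suc n * (z C suc n))) (suc-height k n) ⟩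
      + (suc n * (S C suc n))     ≡⟨ ℤₚ.pos-* (suc n) (S C suc n) ⟩
      N ℤ.* X                     ∎
    distribute : ∀ s x r y → s ℤ.* (x ℤ.- r ℤ.* y) ≡ s ℤ.* x ℤ.- r ℤ.* (s ℤ.* y)
    distribute = ℤ-Ring.solve-∀
    cancel : ∀ r n k x → (r ℤ.* n ℤ.+ k) ℤ.* x ℤ.- r ℤ.* (n ℤ.* x) ≡ k ℤ.* x
    cancel = ℤ-Ring.solve-∀

-- Evaluation of bordered determinants

-- d = 0 covers matB and d = 1 covers matA.
module BorderedFamily
  (q d : ℕ) (u : ℕ → ℕ → ℤ) (t : ℕ → ℕ → ℕ → ℤ)
  (u-zero       : ∀ i → u 0 i ≡ + 0)
  (u-pascal     : ∀ a i → u (suc a) i ≡ (+ 1 ◂ u (d + a)) i ℤ.+ u a i)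
  (t-unit       : ∀ K → UnitLowerTriangular (t K))
  (t-column     : ∀ K i → t K (suc i) 0 ≡ u (d + K) i)
  (t-lowerRight : ∀ K i j → lowerRight (t K) i j ≡ t (d + K + q) i j)
  where

  open FussCatalan q

  mutual
    borderedDet-u : ∀ n a y →
      borderedDet (u a) (t (y + a + q)) (suc n) ≡
      fussCatalan (y + a) (suc n) ℤ.- fussCatalan y (suc n)
    borderedDet-u n zero y = begin
      borderedDet (u 0) (t K) (suc n)
        ≡⟨ borderedDet-cong {u 0} {t = t K} (suc n) u-zero (λ _ _ → refl) ⟩
      borderedDet (λ _ → + 0) (t K) (suc n)
        ≡⟨ borderedDet-zero n (t-unit K) ⟩
      + 0
        ≡⟨ ℤₚ.+-inverseʳ (fussCatalan y (suc n)) ⟨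
      fussCatalan y (suc n) ℤ.- fussCatalan y (suc n)
        ≡⟨ cong (λ x → fussCatalan x (suc n) ℤ.- fussCatalan y (suc n)) (ℕₚ.+-identityʳ y) ⟨
      fussCatalan (y + 0) (suc n) ℤ.- fussCatalan y (suc n) ∎
      where
      open ≡-Reasoning
      K = y + 0 + q
    borderedDet-u n (suc a) y = begin
      borderedDet (u (suc a)) (t K) (suc n)
        ≡⟨ borderedDet-cong {u (suc a)} {t = t K} (suc n) (u-pascal a) (λ _ _ → refl) ⟩
      borderedDet (λ i → (+ 1 ◂ u (d + a)) i ℤ.+ u a i) (t K) (suc n)
        ≡⟨ borderedDet-+ {+ 1 ◂ u (d + a)} {u a} {t K} n (t-unit K) ⟩
      borderedDet (+ 1 ◂ u (d + a)) (t K) (suc n) ℤ.+ borderedDet (u a) (t K) (suc n)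
        ≡⟨ cong₂ ℤ._+_ (borderedDet-1◂u n a y) tail ⟩
      V ℤ.+ (fussCatalan (suc (y + a)) (suc n) ℤ.- fussCatalan (suc y) (suc n))
        ≡⟨ cong₂ (λ x z → V ℤ.+ (fussCatalan x (suc n) ℤ.- z))
                 (sym (ℕₚ.+-suc y a)) (fussCatalan-pascal y n) ⟩
      V ℤ.+ (F ℤ.- (fussCatalan y (suc n) ℤ.+ V))
        ≡⟨ cancel V F (fussCatalan y (suc n)) ⟩
      F ℤ.- fussCatalan y (suc n) ∎
      where
      open ≡-Reasoning
      K = y + suc a + q
      V = fussCatalan (y + suc q) n
      F = fussCatalan (y + suc a) (suc n)
      tail : borderedDet (u a) (t K) (suc n) ≡
             fussCatalan (suc (y + a)) (suc n) ℤ.- fussCatalan (suc y) (suc n)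
      tail = trans (cong (λ z → borderedDet (u a) (t (z + q)) (suc n)) (ℕₚ.+-suc y a))
                   (borderedDet-u n a (suc y))
      cancel : ∀ v f g → v ℤ.+ (f ℤ.- (g ℤ.+ v)) ≡ f ℤ.- g
      cancel = ℤ-Ring.solve-∀

    borderedDet-1◂u : ∀ n a y →
      borderedDet (+ 1 ◂ u (d + a)) (t (y + suc a + q)) (suc n) ≡ fussCatalan (y + suc q) n
    borderedDet-1◂u zero    a y = borderedDet-one (+ 1 ◂ u (d + a)) (t (y + suc a + q))
    borderedDet-1◂u (suc m) a y = begin
      borderedDet (+ 1 ◂ u (d + a)) (t K) (suc (suc m))
        ≡⟨ borderedDet-expand (+ 1 ◂ u (d + a)) m (t-unit K) ⟩
      + 1 ℤ.* dropFirstRowDet (t K) (suc m)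
        ℤ.- borderedDet (u (d + a)) (lowerRight (t K)) (suc m)
        ≡⟨ cong₂ (λ x z → + 1 ℤ.* x ℤ.- z) first rest ⟩
      + 1 ℤ.* (fussCatalan (d + K) (suc m) ℤ.- fussCatalan 0 (suc m))
        ℤ.- (F ℤ.- fussCatalan y′ (suc m))
        ≡⟨ cong₂ (λ x z → + 1 ℤ.* (fussCatalan x (suc m) ℤ.- z) ℤ.- (F ℤ.- fussCatalan y′ (suc m)))
               shifted (fussCatalan-zero m) ⟩
      + 1 ℤ.* (F ℤ.- + 0) ℤ.- (F ℤ.- fussCatalan y′ (suc m))
        ≡⟨ cancel F (fussCatalan y′ (suc m)) ⟩
      fussCatalan y′ (suc m) ∎
      where
      open ≡-Reasoning
      K  = y + suc a + q
      y′ = y + suc q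
      F  = fussCatalan (y′ + (d + a)) (suc m)
      shifted : d + K ≡ y′ + (d + a)
      shifted = identity d y a q
        where
        identity : ∀ d y a q → d + (y + suc a + q) ≡ y + suc q + (d + a)
        identity = ℕ-Ring.solve-∀
      first : dropFirstRowDet (t K) (suc m) ≡
              fussCatalan (d + K) (suc m) ℤ.- fussCatalan 0 (suc m)
      first = trans (borderedDet-cong {λ i → t K (suc i) 0} {t = lowerRight (t K)} (suc m)
                                      (t-column K) (t-lowerRight K))
                    (borderedDet-u m (d + K) 0)
      rest : borderedDet (u (d + a)) (lowerRight (t K)) (suc m) ≡ F ℤ.- fussCatalan y′ (suc m)
      rest = begin
        borderedDet (u (d + a)) (lowerRight (t K)) (suc m)
          ≡⟨ borderedDet-cong {u (d + a)} {t = lowerRight (t K)} (suc m)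
                              (λ _ → refl) (t-lowerRight K) ⟩
        borderedDet (u (d + a)) (t (d + K + q)) (suc m)
          ≡⟨ cong (λ z → borderedDet (u (d + a)) (t (z + q)) (suc m)) shifted ⟩
        borderedDet (u (d + a)) (t (y′ + (d + a) + q)) (suc m)
          ≡⟨ borderedDet-u m (d + a) y′ ⟩
        F ℤ.- fussCatalan y′ (suc m) ∎
      cancel : ∀ f g → + 1 ℤ.* (f ℤ.- + 0) ℤ.- (f ℤ.- g) ≡ g
      cancel = ℤ-Ring.solve-∀

  borderedDet≡fussCatalan : ∀ k n → borderedDet (u k) (t (k + q)) n ≡ fussCatalan k n
  borderedDet≡fussCatalan k zero    = refl
  borderedDet≡fussCatalan k (suc n) = begin
    borderedDet (u k) (t (k + q)) (suc n)
      ≡⟨ borderedDet-u n k 0 ⟩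
    fussCatalan k (suc n) ℤ.- fussCatalan 0 (suc n)
      ≡⟨ cong (λ z → fussCatalan k (suc n) ℤ.- z) (fussCatalan-zero n) ⟩
    fussCatalan k (suc n) ℤ.- + 0
      ≡⟨ ℤₚ.+-identityʳ _ ⟩
    fussCatalan k (suc n) ∎
    where open ≡-Reasoning

-- The binomial matrices

binomialMatrix : (ℕ → ℕ → ℕ) → ℕ → ℕ → ℤ
binomialMatrix top i j = + binomℤ (top i j) (i ⊖ j)

i⊖[1+i+j]≡-[1+j] : ∀ i j → i ⊖ suc (i + j) ≡ -[1+ j ]
i⊖[1+i+j]≡-[1+j] zero    j = refl
i⊖[1+i+j]≡-[1+j] (suc i) j =
  trans (ℤₚ.[1+m]⊖[1+n]≡m⊖n i (suc (i + j))) (i⊖[1+i+j]≡-[1+j] i j)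

binomialMatrix-unitLowerTriangular : ∀ top → UnitLowerTriangular (binomialMatrix top)
binomialMatrix-unitLowerTriangular top = record
  { diagonal = λ i → cong (λ z → + binomℤ (top i i) z) (ℤₚ.n⊖n≡0 i)
  ; above    = λ i j → cong (λ z → + binomℤ (top i (suc (i + j))) z) (i⊖[1+i+j]≡-[1+j] i j)
  }

binomialMatrix-lowerRight : ∀ {top top′} → (∀ i j → top (suc i) (suc j) ≡ top′ i j) →
  ∀ i j → lowerRight (binomialMatrix top) i j ≡ binomialMatrix top′ i j
binomialMatrix-lowerRight top≗top′ i j =
  cong₂ (λ a z → + binomℤ a z) (top≗top′ i j) (ℤₚ.[1+m]⊖[1+n]≡m⊖n i j)

[+i]-[+j]+1≡[1+i]⊖j : ∀ i j → + i ℤ.- + j ℤ.+ + 1 ≡ suc i ⊖ j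
[+i]-[+j]+1≡[1+i]⊖j i j = begin
  + i ℤ.- + j ℤ.+ + 1 ≡⟨ cong (ℤ._+ + 1) (ℤₚ.[+m]-[+n]≡m⊖n i j) ⟩
  i ⊖ j ℤ.+ + 1       ≡⟨ ℤₚ.distribˡ-⊖-+-pos 1 i j ⟩
  i + 1 ⊖ j           ≡⟨ cong (_⊖ j) (ℕₚ.+-comm i 1) ⟩
  suc i ⊖ j           ∎
  where open ≡-Reasoning

det-binomial-bordered : ∀ n {top top′ : ℕ → ℕ → ℕ} {c : ℕ → ℤ} →
  (∀ i → + (top i 0 C suc i) ≡ c i) → (∀ i j → top i (suc j) ≡ top′ i j) →
  det n (λ i j → + binomℤ (top (toℕ i) (toℕ j)) (+ toℕ i ℤ.- + toℕ j ℤ.+ + 1))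
    ≡ borderedDet c (binomialMatrix top′) n
det-binomial-bordered n {top} {top′} {c} first rest =
  det-cong n λ i j → entry (toℕ i) (toℕ j)
  where
  entry : ∀ i j → + binomℤ (top i j) (+ i ℤ.- + j ℤ.+ + 1) ≡ (c i ◂ binomialMatrix top′ i) j
  entry i zero    = trans (cong (λ z → + binomℤ (top i 0) z) ([+i]-[+j]+1≡[1+i]⊖j i 0))
                          (first i)
  entry i (suc j) = cong₂ (λ a z → + binomℤ a z) (rest i j)
                      (trans ([+i]-[+j]+1≡[1+i]⊖j i (suc j)) (ℤₚ.[1+m]⊖[1+n]≡m⊖n i j))

module _ (q : ℕ) where
  open FussCatalan q

  det-matB : ∀ k n → det n (matB (suc q) k n) ≡ fussCatalan k n
  det-matB k n = trans (det-binomial-bordered n {λ _ j → q * j + k} first rest)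
                       (borderedDet≡fussCatalan k n)
    where
    u : ℕ → ℕ → ℤ
    u a i = + (a C suc i)
    top : ℕ → ℕ → ℕ → ℕ
    top K _ j = j * q + K
    pascal : ∀ a i → u (suc a) i ≡ (+ 1 ◂ u a) i ℤ.+ u a i
    pascal a zero    = pascalℤ a zero
    pascal a (suc i) = pascalℤ a (suc i)
    shift : ∀ K i j → top K (suc i) (suc j) ≡ top (K + q) i j
    shift K i j = identity q K j
      where
      identity : ∀ q K j → q + j * q + K ≡ j * q + (K + q)
      identity = ℕ-Ring.solve-∀
    open BorderedFamily q 0 u (binomialMatrix ∘ top) (λ _ → refl) pascal
      (λ K → binomialMatrix-unitLowerTriangular (top K)) (λ _ _ → refl)
      (λ K → binomialMatrix-lowerRight {top K} (shift K))
    first : ∀ i → + ((q * 0 + k) C suc i) ≡ u k i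
    first i = cong (λ z → + ((z + k) C suc i)) (ℕₚ.*-zeroʳ q)
    rest : ∀ i j → q * suc j + k ≡ top (k + q) i j
    rest i j = identity q k j
      where
      identity : ∀ q k j → q * suc j + k ≡ j * q + (k + q)
      identity = ℕ-Ring.solve-∀

  det-matA : ∀ k n → det n (matA (suc q) k n) ≡ fussCatalan k n
  det-matA k n = trans (det-binomial-bordered n {λ i j → i + q * j + k} first rest)
                       (borderedDet≡fussCatalan k n)
    where
    u : ℕ → ℕ → ℤ
    u a i = + ((a + i) C suc i)
    top : ℕ → ℕ → ℕ → ℕ
    top K i j = j * q + K + i
    u-zero : ∀ i → u 0 i ≡ + 0
    u-zero i = cong +_ (k>n⇒nCk≡0 (ℕₚ.n<1+n i))
    pascal : ∀ a i → u (suc a) i ≡ (+ 1 ◂ u (suc a)) i ℤ.+ u a i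
    pascal a zero    = pascalℤ (a + 0) zero
    pascal a (suc i) = trans (pascalℤ (a + suc i) (suc i))
                             (cong (λ z → + (z C suc i) ℤ.+ u a (suc i)) (ℕₚ.+-suc a i))
    column : ∀ K i → binomialMatrix (top K) (suc i) 0 ≡ u (suc K) i
    column K i = cong (λ z → + (z C suc i)) (ℕₚ.+-suc K i)
    shift : ∀ K i j → top K (suc i) (suc j) ≡ top (suc K + q) i j
    shift K i j = identity q K i j
      where
      identity : ∀ q K i j → q + j * q + K + suc i ≡ j * q + (suc K + q) + i
      identity = ℕ-Ring.solve-∀
    open BorderedFamily q 1 u (binomialMatrix ∘ top) u-zero pascal
      (λ K → binomialMatrix-unitLowerTriangular (top K)) column
      (λ K → binomialMatrix-lowerRight {top K} (shift K))
    first : ∀ i → + ((i + q * 0 + k) C suc i) ≡ u k i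
    first i = cong (λ z → + (z C suc i)) (identity q i k)
      where
      identity : ∀ q i k → i + q * 0 + k ≡ k + i
      identity = ℕ-Ring.solve-∀
    rest : ∀ i j → i + q * suc j + k ≡ top (k + q) i j
    rest i j = identity q i j k
      where
      identity : ∀ q i j k → i + q * suc j + k ≡ j * q + (k + q) + i
      identity = ℕ-Ring.solve-∀

mainTheorem12 : (r k n : ℕ) → r ≥ 1 → k ≥ 1 →
    (det n (matA r k n) ≡ det n (matB r k n))
    × ((+ (r ℕ.* n ℕ.+ k)) ℤ.* det n (matB r k n)
        ≡ + (k ℕ.* ((r ℕ.* n ℕ.+ k) C n)))
mainTheorem12 zero    k n () _
mainTheorem12 (suc q) k n _  _ =
  trans (det-matA q k n) (sym (det-matB q k n)) ,
  trans (cong (+ (suc q * n + k) ℤ.*_) (det-matB q k n)) (fussCatalan-closed k n)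
  where open FussCatalan q
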